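{- Let $n,k$ be positive integers, let $V$ be a set with $|V|=n$, and let $M$ be the $\binom{n}{k}\times n$ 0/1-matrix whose rows are indexed by the $k$-element subsets $F\subseteq V$ and whose columns are indexed by the elements $v\in V$, with $M_{F,v}=1$ if $v\notin F$ and $M_{F,v}=0$ otherwise. Then $\mathrm{rc}(M) = \Omega\left(\min\left\{n,\frac{(k+1)(k+2)}{2}\right\}\right)$.
   Context: For a real matrix $M$, a rectangle is a set $I\times J$ with $I$ a set of row indices and $J$ a set of column indices. A rectangle covering of $M$ is a set of rectangles, each contained in $\mathrm{supp}(M)=\{(i,j): M_{i,j}\neq 0\}$, whose union equals $\mathrm{supp}(M)$. The rectangle covering number $\mathrm{rc}(M)$ is the minimum cardinality of a rectangle covering of $M$. The $\Omega$ hides an absolute positive constant. -}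

module Defs where

open import Data.Nat using (ℕ; zero; suc)
open import Data.Fin using (Fin)
open import Data.Fin.Subset using (Subset; Side; inside; outside; ∣_∣)
open import Data.Vec using (lookup)
open import Data.Product using (Σ; ∃; _×_; _,_)
open import Relation.Binary.PropositionalEquality using (_≡_; _≢_)

-- A real matrix with rows indexed by R and columns by C.  Only the
-- support matters for rectangle coverings; our matrices have 0/1 entries,
-- so we take entries in ℕ.
Matrix : Set → Set → Set
Matrix R C = R → C → ℕ

record Rectangle (R C : Set) : Set₁ where
  field
    rows : R → Set
    cols : C → Set
open Rectangle public

IsRectangleCovering : {R C : Set} (M : Matrix R C) {r : ℕ} → (Fin r → Rectangle R C) → Set
IsRectangleCovering {R} {C} M {r} rect =
  (∀ (t : Fin r) (i : R) (j : C) → rows (rect t) i → cols (rect t) j → M i j ≢ 0)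
  × (∀ (i : R) (j : C) → M i j ≢ 0 → ∃ λ (t : Fin r) → rows (rect t) i × cols (rect t) j)

KSubset : ℕ → ℕ → Set
KSubset n k = Σ (Subset n) (λ F → ∣ F ∣ ≡ k)

sideEntry : Side → ℕ
sideEntry inside  = 0
sideEntry outside = 1

nonMembershipMatrix : (n k : ℕ) → Matrix (KSubset n k) (Fin n)
nonMembershipMatrix n k (F , _) v = sideEntry (lookup F v)

-- Read each rectangle I × J through its column set J.  Since J avoids every row F ∈ I, a
-- covering yields r sets W ⊆ V such that for every k-set F and every y ∉ F some W contains y
-- and misses F.  Such a family has at least min(n, T k) members, T k = (k+1)(k+2)/2, by
-- induction on k.  If some y lies in more than k+1 members, drop those members and delete y
-- from the others: adding y to F shows the result serves the (k-1)-sets of V ∖ {y}, so the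
-- family has at least min(n-1, T (k-1)) + (k+1) ≥ min(n, T k) members.  Otherwise every {y}
-- is itself a member, giving n members: if no member is {y}, pick a member through y and a
-- second point z of it and delete z; this keeps the covering property for k-1 and lowers
-- the degree of y, so after k steps y still lies in a member, i.e. its degree exceeds k.
module Submission where

open import Defs
open import Data.Nat using (ℕ; zero; suc; _+_; _*_; _≤_; _<_; _⊓_; z≤n; s≤s; _<?_; _≤?_)
open import Data.Nat.DivMod using (_/_; m*n/n≡m)
open import Data.Nat.Properties
open import Data.Nat.Tactic.RingSolver using (solve-∀)
open import Data.Fin using (Fin; zero; suc; punchIn; punchOut)
open import Data.Fin.Properties using (punchIn-punchOut; ¬∀⟶∃¬; injective⇒≤; any?; all?) renaming (_≟_ to _≟ᶠ_)
open import Data.Fin.Subset using (Subset; inside; outside; ∣_∣)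
open import Data.Vec using ([]; _∷_; lookup; insertAt)
open import Data.Vec.Properties using (insertAt-lookup; insertAt-punchIn)
open import Data.Bool using (Bool; true; false; if_then_else_)
open import Data.Bool.Properties using () renaming (_≟_ to _≟ᵇ_)
open import Data.List using (List; []; _∷_; length; tabulate)
import Data.List as List
open import Data.List.Properties using (length-tabulate)
open import Data.List.Relation.Unary.Any using (Any; here; there)
import Data.List.Relation.Unary.Any as Any
open import Data.List.Relation.Unary.Any.Properties using (lookup-index; tabulate⁺)
open import Data.List.Relation.Unary.All using (All; []; _∷_)
import Data.List.Relation.Unary.All as All
open import Data.List.Relation.Unary.All.Properties using (¬Any⇒All¬)
open import Data.Product using (Σ; ∃; _×_; _,_; proj₁)
import Data.Product as Product
open import Data.Sum using (_⊎_; inj₁; inj₂; fromInj₂)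
open import Function using (_∘_; _$_; id)
open import Function.Definitions using (Injective)
open import Relation.Nullary using (¬_; Dec; yes; no; does; contradiction)
open import Relation.Nullary.Decidable using (decidable-stable; ¬¬-excluded-middle; dec-true; _→-dec_; _×-dec_)
open import Relation.Binary.PropositionalEquality

Family : ℕ → Set
Family n = List (Fin n → Bool)

without : ∀ {n} → Fin (suc n) → Family (suc n) → Family n
without x [] = []
without x (W ∷ Ws) with W x
... | true  = without x Ws
... | false = W ∘ punchIn x ∷ without x Ws

degree : ∀ {n} → Family n → Fin n → ℕ
degree []       y = 0
degree (W ∷ Ws) y = if W y then suc (degree Ws y) else degree Ws y

length-without : ∀ {n} (x : Fin (suc n)) Ws → length (without x Ws) + degree Ws x ≡ length Ws
length-without x [] = refl
length-without x (W ∷ Ws) with W x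
... | true  = trans (+-suc _ _) (cong suc (length-without x Ws))
... | false = cong suc (length-without x Ws)

degree≤length : ∀ {n} (Ws : Family n) y → degree Ws y ≤ length Ws
degree≤length []       y = z≤n
degree≤length (W ∷ Ws) y with W y
... | true  = s≤s (degree≤length Ws y)
... | false = m≤n⇒m≤1+n (degree≤length Ws y)

Any⇒0<degree : ∀ {n} {Ws : Family n} {y} → Any (λ W → W y ≡ true) Ws → 0 < degree Ws y
Any⇒0<degree {Ws = W ∷ Ws} {y} (here Wy) rewrite Wy = s≤s z≤n
Any⇒0<degree {Ws = W ∷ Ws} {y} (there a) with W y
... | true  = s≤s z≤n
... | false = Any⇒0<degree a

-- The offset c lets one induction step serve both degree-without-≤ and degree-without-<.
degree-without-∷ : ∀ {n} (x : Fin (suc n)) W Ws y {c} →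
  c + degree (without x Ws) y ≤ degree Ws (punchIn x y) →
  c + degree (without x (W ∷ Ws)) y ≤ degree (W ∷ Ws) (punchIn x y)
degree-without-∷ x W Ws y h with W x
... | true with W (punchIn x y)
...   | true  = m≤n⇒m≤1+n h
...   | false = h
degree-without-∷ x W Ws y {c} h | false with W (punchIn x y)
...   | true  = ≤-trans (≤-reflexive (+-suc c _)) (s≤s h)
...   | false = h

degree-without-≤ : ∀ {n} (x : Fin (suc n)) Ws y → degree (without x Ws) y ≤ degree Ws (punchIn x y)
degree-without-≤ x []       y = z≤n
degree-without-≤ x (W ∷ Ws) y = degree-without-∷ x W Ws y (degree-without-≤ x Ws y)

degree-without-< : ∀ {n} (x : Fin (suc n)) Ws y →
  Any (λ W → W x ≡ true × W (punchIn x y) ≡ true) Ws →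
  degree (without x Ws) y < degree Ws (punchIn x y)
degree-without-< x (W ∷ Ws) y (here (Wx , Wy)) rewrite Wx | Wy = s≤s (degree-without-≤ x Ws y)
degree-without-< x (W ∷ Ws) y (there a) = degree-without-∷ x W Ws y (degree-without-< x Ws y a)

module _ {n} {P : (Fin (suc n) → Bool) → Set} {Q : (Fin n → Bool) → Set} (x : Fin (suc n)) where

  Any-without : (∀ {W} → P W → W x ≡ false × Q (W ∘ punchIn x)) →
                ∀ {Ws} → Any P Ws → Any Q (without x Ws)
  Any-without f {W ∷ Ws} (here p) with W x | f p
  ... | true  | () , _
  ... | false | _ , q = here q
  Any-without f {W ∷ Ws} (there a) with W x
  ... | true  = Any-without f a
  ... | false = there (Any-without f a)

  All-without : (∀ {W} → W x ≡ false → P W → Q (W ∘ punchIn x)) →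
                ∀ {Ws} → All P Ws → All Q (without x Ws)
  All-without f {[]}     []       = []
  All-without f {W ∷ Ws} (p ∷ ps) with W x in Wx
  ... | true  = All-without f ps
  ... | false = f Wx p ∷ All-without f ps

Covers : ∀ {n} → ℕ → Family n → Set
Covers {n} k Ws = ∀ (F : Subset n) → ∣ F ∣ ≡ k → ∀ y → lookup F y ≡ outside →
  Any (λ W → W y ≡ true × (∀ z → W z ≡ true → lookup F z ≡ outside)) Ws

∣insertAt-inside∣ : ∀ {n} (F : Subset n) x → ∣ insertAt F x inside ∣ ≡ suc ∣ F ∣
∣insertAt-inside∣ F             zero    = refl
∣insertAt-inside∣ (inside ∷ F)  (suc x) = cong suc (∣insertAt-inside∣ F x)
∣insertAt-inside∣ (outside ∷ F) (suc x) = ∣insertAt-inside∣ F x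

∣insertAt-outside∣ : ∀ {n} (F : Subset n) x → ∣ insertAt F x outside ∣ ≡ ∣ F ∣
∣insertAt-outside∣ F             zero    = refl
∣insertAt-outside∣ (inside ∷ F)  (suc x) = cong suc (∣insertAt-outside∣ F x)
∣insertAt-outside∣ (outside ∷ F) (suc x) = ∣insertAt-outside∣ F x

Covers-without : ∀ {n k} {Ws : Family (suc n)} x → Covers (suc k) Ws → Covers k (without x Ws)
Covers-without {n} {Ws = Ws} x cover F refl y Fy =
  Any-without x separate
    (cover F⁺ (∣insertAt-inside∣ F x) (punchIn x y) (trans (insertAt-punchIn F x inside y) Fy))
  where
  F⁺ = insertAt F x inside
  separate : ∀ {W : Fin (suc n) → Bool} →
             W (punchIn x y) ≡ true × (∀ z → W z ≡ true → lookup F⁺ z ≡ outside) →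
             W x ≡ false × W (punchIn x y) ≡ true × (∀ z → W (punchIn x z) ≡ true → lookup F z ≡ outside)
  separate {W} (Wy , W⊆∁F⁺) =
    Wx , Wy , λ z Wz → trans (sym (insertAt-punchIn F x inside z)) (W⊆∁F⁺ (punchIn x z) Wz)
    where
    Wx : W x ≡ false
    Wx with W x in eq
    ... | false = refl
    ... | true with () ← trans (sym (insertAt-lookup F x inside)) (W⊆∁F⁺ x eq)

kSubset : ∀ {n k} → k ≤ n → Σ (Subset n) λ F → ∣ F ∣ ≡ k
kSubset {zero}  z≤n = [] , refl
kSubset {suc n} z≤n = Product.map (outside ∷_) id (kSubset z≤n)
kSubset {suc n} (s≤s k≤n) = Product.map (inside ∷_) (cong suc) (kSubset k≤n)

kSubset-avoiding : ∀ {n k} → k < suc n → (y : Fin (suc n)) →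
                   Σ (Subset (suc n)) λ F → ∣ F ∣ ≡ k × lookup F y ≡ outside
kSubset-avoiding (s≤s k≤n) y =
  let F , ∣F∣≡k = kSubset k≤n in
  insertAt F y outside , trans (∣insertAt-outside∣ F y) ∣F∣≡k , insertAt-lookup F y outside

Covers⇒Any : ∀ {n k} {Ws : Family n} → k < n → Covers k Ws → ∀ y → Any (λ W → W y ≡ true) Ws
Covers⇒Any {suc n} k<n cover y =
  let F , ∣F∣≡k , Fy = kSubset-avoiding k<n y in
  Any.map proj₁ (cover F ∣F∣≡k y Fy)

IsSingleton : ∀ {n} → Fin n → (Fin n → Bool) → Set
IsSingleton y W = W y ≡ true × (∀ z → W z ≡ true → z ≡ y)

allSingletons⇒n≤length : ∀ {n} {Ws : Family n} → (∀ y → Any (IsSingleton y) Ws) → n ≤ length Ws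
allSingletons⇒n≤length {Ws = Ws} singleton = injective⇒≤ index-injective
  where
  index-injective : Injective _≡_ _≡_ (Any.index ∘ singleton)
  index-injective {y} {y′} same-index =
    let _ , only-y = lookup-index (singleton y)
        y′∈W , _   = lookup-index (singleton y′)
    in sym (only-y y′ (subst (λ i → List.lookup Ws i y′ ≡ true) (sym same-index) y′∈W))

NotSingleton : ∀ {n} → Fin n → (Fin n → Bool) → Set
NotSingleton {n} y W = W y ≡ true → ∃ λ z → z ≢ y × W z ≡ true

¬IsSingleton⇒NotSingleton : ∀ {n} {y : Fin n} {W} → ¬ IsSingleton y W → NotSingleton y W
¬IsSingleton⇒NotSingleton {n} {y} {W} ¬singleton Wy
  with z , ¬[Wz⇒z≡y] ← ¬∀⟶∃¬ n _ (λ z → (W z ≟ᵇ true) →-dec (z ≟ᶠ y)) (λ W⊆y → ¬singleton (Wy , W⊆y))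
  with W z in Wz
... | true  = z , (λ z≡y → ¬[Wz⇒z≡y] (λ _ → z≡y)) , Wz
... | false = contradiction (λ ()) ¬[Wz⇒z≡y]

NotSingleton-without : ∀ {n} {x : Fin (suc n)} {y W} → W x ≡ false →
                       NotSingleton (punchIn x y) W → NotSingleton y (W ∘ punchIn x)
NotSingleton-without {x = x} {y} {W} Wx notSingleton Wy =
  let z , z≢y , Wz = notSingleton Wy
      x≢z : x ≢ z
      x≢z x≡z = contradiction (trans (sym Wx) (trans (cong W x≡z) Wz)) λ ()
  in punchOut x≢z , (λ eq → z≢y (trans (sym (punchIn-punchOut x≢z)) (cong (punchIn x) eq))) ,
     trans (cong W (punchIn-punchOut x≢z)) Wz

secondPoint : ∀ {n} {y : Fin n} {Ws} → All (NotSingleton y) Ws → Any (λ W → W y ≡ true) Ws →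
  ∃ λ z → z ≢ y × Any (λ W → W z ≡ true × W y ≡ true) Ws
secondPoint (notSingleton ∷ _) (here Wy) = let z , z≢y , Wz = notSingleton Wy in z , z≢y , here (Wz , Wy)
secondPoint (_ ∷ notSingletons) (there a) = Product.map₂ (Product.map₂ there) (secondPoint notSingletons a)

noSingleton⇒k<degree : ∀ k {n} {Ws : Family n} {y} → k < n → Covers k Ws →
                       All (NotSingleton y) Ws → k < degree Ws y
noSingleton⇒k<degree zero    k<n cover _ = Any⇒0<degree (Covers⇒Any k<n cover _)
noSingleton⇒k<degree (suc k) {suc n} {Ws} {y} k<n′@(s≤s k<n) cover notSingletons
  with z , z≢y , shared ← secondPoint notSingletons (Covers⇒Any k<n′ cover y)
  with y′ ← punchOut z≢y | refl ← punchIn-punchOut z≢y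
  = ≤-trans (s≤s (noSingleton⇒k<degree k k<n (Covers-without z cover) notSingletons′))
            (degree-without-< z Ws y′ shared)
  where notSingletons′ = All-without z NotSingleton-without notSingletons

isSingleton? : ∀ {n} (y : Fin n) W → Dec (IsSingleton y W)
isSingleton? y W = (W y ≟ᵇ true) ×-dec all? (λ z → (W z ≟ᵇ true) →-dec (z ≟ᶠ y))

highDegree-or-singleton : ∀ {n k} {Ws : Family n} → k < n → Covers k Ws →
                          ∀ y → k < degree Ws y ⊎ Any (IsSingleton y) Ws
highDegree-or-singleton {Ws = Ws} k<n cover y with Any.any? (isSingleton? y) Ws
... | yes singleton  = inj₂ singleton
... | no ¬singleton =
  inj₁ (noSingleton⇒k<degree _ k<n cover (All.map ¬IsSingleton⇒NotSingleton (¬Any⇒All¬ Ws ¬singleton)))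

triangle : ℕ → ℕ
triangle zero    = 1
triangle (suc k) = triangle k + suc (suc k)

triangle*2 : ∀ k → triangle k * 2 ≡ suc k * suc (suc k)
triangle*2 zero    = refl
triangle*2 (suc k) = begin
  (triangle k + suc (suc k)) * 2          ≡⟨ *-distribʳ-+ 2 (triangle k) (suc (suc k)) ⟩
  triangle k * 2 + suc (suc k) * 2        ≡⟨ cong (_+ suc (suc k) * 2) (triangle*2 k) ⟩
  suc k * suc (suc k) + suc (suc k) * 2   ≡⟨ expand k ⟩
  suc (suc k) * suc (suc (suc k))         ∎
  where
  open ≡-Reasoning
  expand : ∀ m → suc m * suc (suc m) + suc (suc m) * 2 ≡ suc (suc m) * suc (suc (suc m))
  expand = solve-∀

triangle≡[1+k][2+k]/2 : ∀ k → triangle k ≡ (suc k * suc (suc k)) / 2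
triangle≡[1+k][2+k]/2 k = trans (sym (m*n/n≡m (triangle k) 2)) (cong (_/ 2) (triangle*2 k))

1+m⊓[n+1+o]≤m⊓n+1+o : ∀ m n o → suc m ⊓ (n + suc o) ≤ m ⊓ n + suc o
1+m⊓[n+1+o]≤m⊓n+1+o m n o = begin
  suc m ⊓ (n + suc o)        ≤⟨ ⊓-monoˡ-≤ (n + suc o) (≤-trans (s≤s (m≤m+n m o)) (≤-reflexive (sym (+-suc m o)))) ⟩
  (m + suc o) ⊓ (n + suc o)  ≡⟨ +-distribʳ-⊓ (suc o) m n ⟨
  m ⊓ n + suc o              ∎
  where open ≤-Reasoning

coveringBound : ∀ k {n} {Ws : Family n} → k < n → Covers k Ws → n ⊓ triangle k ≤ length Ws
coveringBound zero {suc n} {Ws} k<n cover = begin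
  suc n ⊓ 1       ≤⟨ m⊓n≤n (suc n) 1 ⟩
  1               ≤⟨ Any⇒0<degree (Covers⇒Any k<n cover zero) ⟩
  degree Ws zero  ≤⟨ degree≤length Ws zero ⟩
  length Ws       ∎
  where open ≤-Reasoning
coveringBound (suc k) {suc n} {Ws} k<n′@(s≤s k<n) cover with any? (λ y → suc k <? degree Ws y)
... | yes (y , k+1<degree) = begin
  suc n ⊓ (triangle k + suc (suc k))    ≤⟨ 1+m⊓[n+1+o]≤m⊓n+1+o n (triangle k) (suc k) ⟩
  n ⊓ triangle k + suc (suc k)          ≤⟨ +-mono-≤ (coveringBound k k<n (Covers-without y cover)) k+1<degree ⟩
  length (without y Ws) + degree Ws y   ≡⟨ length-without y Ws ⟩
  length Ws                             ∎
  where open ≤-Reasoning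
... | no ¬highDegree = ≤-trans (m⊓n≤m (suc n) _) (allSingletons⇒n≤length singleton)
  where
  singleton : ∀ y → Any (IsSingleton y) Ws
  singleton y = fromInj₂ (λ k+1<degree → contradiction (y , k+1<degree) ¬highDegree)
                         (highDegree-or-singleton k<n′ cover y)

fromDoes : ∀ {A : Set} (a? : Dec A) → does a? ≡ true → A
fromDoes (yes a) _ = a

sideEntry≢0⇒outside : ∀ s → sideEntry s ≢ 0 → s ≡ outside
sideEntry≢0⇒outside inside  entry≢0 = contradiction refl entry≢0
sideEntry≢0⇒outside outside _       = refl

module _ {n k r} (rect : Fin r → Rectangle (KSubset n k) (Fin n)) (cols? : ∀ t v → Dec (cols (rect t) v)) where

  columnFamily : Family n
  columnFamily = tabulate λ t v → does (cols? t v)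

  RectangleCovering⇒Covers : IsRectangleCovering (nonMembershipMatrix n k) rect → Covers k columnFamily
  RectangleCovering⇒Covers (inSupport , covered) F ∣F∣≡k y Fy =
    let t , F∈rows , y∈cols = covered (F , ∣F∣≡k) y (subst (λ s → sideEntry s ≢ 0) (sym Fy) λ ())
    in tabulate⁺ t (dec-true (cols? t y) y∈cols ,
                    λ z z∈W → sideEntry≢0⇒outside _ (inSupport t _ z F∈rows (fromDoes (cols? t z) z∈W)))

  rectangleCoveringBound : k < n → IsRectangleCovering (nonMembershipMatrix n k) rect → n ⊓ triangle k ≤ r
  rectangleCoveringBound k<n covering =
    subst (n ⊓ triangle k ≤_) (length-tabulate _) (coveringBound k k<n (RectangleCovering⇒Covers covering))

¬¬-Π-Fin : ∀ m {P : Fin m → Set} → (∀ i → ¬ ¬ P i) → ¬ ¬ (∀ i → P i)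
¬¬-Π-Fin zero    _    ¬all = ¬all λ ()
¬¬-Π-Fin (suc m) ¬¬P  ¬all =
  ¬¬P zero λ P₀ → ¬¬-Π-Fin m (¬¬P ∘ suc) λ Pₛ → ¬all λ { zero → P₀ ; (suc i) → Pₛ i }

-- The column sets need not be decidable, but the
-- bound is a decidable proposition, so it may be proved under ¬¬ excluded middle for the
-- finitely many memberships v ∈ J.
proposition5p16 : Σ ℕ λ C → ∀ (n k : ℕ) → 1 ≤ k → k < n →
    ∀ (r : ℕ) (rect : Fin r → Rectangle (KSubset n k) (Fin n)) →
    IsRectangleCovering (nonMembershipMatrix n k) rect →
    n ⊓ ((suc k * suc (suc k)) / 2) ≤ C * r
proposition5p16 = 1 , λ n k _ k<n r rect covering →
  subst₂ (λ T r′ → n ⊓ T ≤ r′) (triangle≡[1+k][2+k]/2 k) (sym (*-identityˡ r)) $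
  decidable-stable (n ⊓ triangle k ≤? r) λ bound-fails →
  ¬¬-Π-Fin r (λ t → ¬¬-Π-Fin n λ v → ¬¬-excluded-middle) λ cols? →
  bound-fails (rectangleCoveringBound rect cols? k<n covering)
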